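{- Let $c$ be a well-formed GCL command and $f$ a label with $\mathsf{okf}(c,f)$, let $pc$ be a variable, and suppose $c\triangleright_f gcs$ (for $pc$). Then $[\![\mathsf{enab}(gcs)]\!]=[\![\bigvee_{i\in\mathsf{labs}(c)}pc=i]\!]$, i.e., in every store, $\mathsf{enab}(gcs)$ holds iff the value of $pc$ belongs to $\mathsf{labs}(c)$.
   Context: Stores are total maps from integer variables to $\mathbb{Z}$. GCL commands: $c ::= \mathsf{skip}^n \mid x :=^n e \mid c;c \mid \mathsf{if}^n\, gcs\,\mathsf{fi} \mid \mathsf{do}^n\, gcs\,\mathsf{od}$, $gcs ::= e\to c \mid e\to c\,\square\,gcs$, integer labels $n$; $\mathsf{enab}(gcs)$ is the disjunction of guards. Well formed: well typed and every subcommand $\mathsf{if}^n gcs\,\mathsf{fi}$ has $\mathsf{enab}(gcs)$ true in every store. $\mathsf{lab}(c)$ is the label of $c$ ($\mathsf{lab}(c;d)=\mathsf{lab}(c)$); $\mathsf{labs}(c)$ the set of all labels occurring in $c$; $\mathsf{okf}(c,f)$: labels of $c$ are positive and pairwise distinct and $f\notin\mathsf{labs}(c)$. For the variable $pc$: $!n$ is $pc:=n$, $?n$ is $pc=n$. Normal form bodies $c\triangleright_f gcs$: $\mathsf{skip}^n\triangleright_f(?n\to !f)$; $x:=^ne\triangleright_f(?n\to x:=e;!f)$; if $c\triangleright_{\mathsf{lab}(d)}gcs_0$ and $d\triangleright_f gcs_1$ then $c;d\triangleright_f gcs_0\,\square\,gcs_1$; for $gcs=e_1\to d_1\,\square\cdots\square\,e_k\to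 d_k$: if $d_i\triangleright_f g_i$ for all $i$ then $\mathsf{if}^n gcs\,\mathsf{fi}\triangleright_f(?n\wedge e_1\to !\mathsf{lab}(d_1))\square\cdots\square(?n\wedge e_k\to !\mathsf{lab}(d_k))\square g_1\square\cdots\square g_k$; if $d_i\triangleright_n g_i$ for all $i$ then $\mathsf{do}^n gcs\,\mathsf{od}\triangleright_f(?n\wedge e_1\to !\mathsf{lab}(d_1))\square\cdots\square(?n\wedge e_k\to !\mathsf{lab}(d_k))\square(?n\wedge\neg\mathsf{enab}(gcs)\to !f)\square g_1\square\cdots\square g_k$. $[\![e]\!]$ for a boolean expression denotes the set of stores where it is true. -}

module Defs where

open import Data.Bool using (Bool; true; false; _∧_; _∨_; not; T)
open import Data.Integer using (ℤ; +_; _<_) renaming (_+_ to _+ℤ_; _-_ to _-ℤ_; _*_ to _*ℤ_)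
import Data.Integer.Properties as ℤP
open import Data.Nat using (ℕ)
import Data.Nat.Properties as ℕP
open import Data.List using (List; []; _∷_; _++_)
open import Data.List.Relation.Unary.All using (All)
open import Data.List.Relation.Unary.Unique.Propositional using (Unique)
open import Data.List.Membership.Propositional using (_∉_)
open import Data.Product using (_×_)
open import Data.Unit using (⊤)
open import Relation.Nullary.Decidable using (⌊_⌋)

Var : Set
Var = ℕ

Store : Set
Store = Var → ℤ

-- Integer and boolean expressions (separate syntactic categories, so
-- every expression is well typed by construction).
data AExp : Set where
  num  : ℤ → AExp
  var  : Var → AExp
  _⊕_  : AExp → AExp → AExp
  _⊖_  : AExp → AExp → AExp
  _⊛_  : AExp → AExp → AExp

data BExp : Set where
  btrue  : BExp
  bfalse : BExp
  _≐_    : AExp → AExp → BExp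
  _≺_    : AExp → AExp → BExp
  bnot   : BExp → BExp
  _∧ᵇ_   : BExp → BExp → BExp
  _∨ᵇ_   : BExp → BExp → BExp

evalA : AExp → Store → ℤ
evalA (num z) σ = z
evalA (var x) σ = σ x
evalA (a ⊕ b) σ = evalA a σ +ℤ evalA b σ
evalA (a ⊖ b) σ = evalA a σ -ℤ evalA b σ
evalA (a ⊛ b) σ = evalA a σ *ℤ evalA b σ

evalB : BExp → Store → Bool
evalB btrue σ = true
evalB bfalse σ = false
evalB (a ≐ b) σ = ⌊ evalA a σ ℤP.≟ evalA b σ ⌋
evalB (a ≺ b) σ = ⌊ evalA a σ ℤP.<? evalA b σ ⌋
evalB (bnot b) σ = not (evalB b σ)
evalB (b ∧ᵇ c) σ = evalB b σ ∧ evalB c σ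
evalB (b ∨ᵇ c) σ = evalB b σ ∨ evalB c σ

⟦_⟧ : BExp → Store → Set
⟦ e ⟧ σ = T (evalB e σ)

mutual
  data Cmd : Set where
    skip   : ℤ → Cmd
    assign : ℤ → Var → AExp → Cmd
    _⨾_    : Cmd → Cmd → Cmd
    ifc    : ℤ → GCS → Cmd
    doc    : ℤ → GCS → Cmd

  data GCS : Set where
    [_⇒_]   : BExp → Cmd → GCS
    _⇒_□_   : BExp → Cmd → GCS → GCS

infixr 4 _□_
_□_ : GCS → GCS → GCS
[ e ⇒ c ] □ h = e ⇒ c □ h
(e ⇒ c □ g) □ h = e ⇒ c □ (g □ h)

enab : GCS → BExp
enab [ e ⇒ c ] = e
enab (e ⇒ c □ g) = e ∨ᵇ enab g

lab : Cmd → ℤ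
lab (skip n) = n
lab (assign n x e) = n
lab (c ⨾ d) = lab c
lab (ifc n g) = n
lab (doc n g) = n

mutual
  labs : Cmd → List ℤ
  labs (skip n) = n ∷ []
  labs (assign n x e) = n ∷ []
  labs (c ⨾ d) = labs c ++ labs d
  labs (ifc n g) = n ∷ labsG g
  labs (doc n g) = n ∷ labsG g

  labsG : GCS → List ℤ
  labsG [ e ⇒ c ] = labs c
  labsG (e ⇒ c □ g) = labs c ++ labsG g

mutual
  WF : Cmd → Set
  WF (skip n) = ⊤
  WF (assign n x e) = ⊤
  WF (c ⨾ d) = WF c × WF d
  WF (ifc n g) = (∀ σ → ⟦ enab g ⟧ σ) × WFG g
  WF (doc n g) = WFG g

  WFG : GCS → Set
  WFG [ e ⇒ c ] = WF c
  WFG (e ⇒ c □ g) = WF c × WFG g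

okf : Cmd → ℤ → Set
okf c f = All (λ n → + 0 < n) (labs c) × Unique (labs c) × f ∉ labs c

-- The auxiliary assignments occurring in the
-- bodies of normal-form guarded commands carry the (irrelevant) label 0.
module NormalForm (pc : Var) where

  !_ : ℤ → Cmd
  ! n = assign (+ 0) pc (num n)

  ¿_ : ℤ → BExp
  ¿ n = var pc ≐ num n

  entry : ℤ → GCS → GCS
  entry n [ e ⇒ d ] = [ ((¿ n) ∧ᵇ e) ⇒ (! lab d) ]
  entry n (e ⇒ d □ g) = ((¿ n) ∧ᵇ e) ⇒ (! lab d) □ entry n g

  mutual
    data _▷[_]_ : Cmd → ℤ → GCS → Set where
      nf-skip   : ∀ {n f} → skip n ▷[ f ] [ (¿ n) ⇒ (! f) ]
      nf-assign : ∀ {n x e f} →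
                  assign n x e ▷[ f ] [ (¿ n) ⇒ (assign (+ 0) x e ⨾ (! f)) ]
      nf-seq    : ∀ {c d f g₀ g₁} → c ▷[ lab d ] g₀ → d ▷[ f ] g₁ →
                  (c ⨾ d) ▷[ f ] (g₀ □ g₁)
      nf-if     : ∀ {n gcs f G} → gcs ▷G[ f ] G →
                  ifc n gcs ▷[ f ] (entry n gcs □ G)
      nf-do     : ∀ {n gcs f G} → gcs ▷G[ n ] G →
                  doc n gcs ▷[ f ] (entry n gcs □ [ ((¿ n) ∧ᵇ bnot (enab gcs)) ⇒ (! f) ] □ G)

    data _▷G[_]_ : GCS → ℤ → GCS → Set where
      nfg-one  : ∀ {e d f g} → d ▷[ f ] g → [ e ⇒ d ] ▷G[ f ] g
      nfg-cons : ∀ {e d gs f g G} → d ▷[ f ] g → gs ▷G[ f ] G →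
                 (e ⇒ d □ gs) ▷G[ f ] (g □ G)

{-# OPTIONS --safe #-}
-- An if or do with label n contributes the guards
-- ?n ∧ eᵢ: for an if their disjunction is ?n because enab of its guarded
-- commands is valid (well formedness); for a do the exit guard ?n ∧ ¬enab
-- covers exactly the remaining stores with pc = n.
module Submission where

open import Defs
open import Data.Bool using (Bool; true; _∧_; _∨_; not; T)
open import Data.Bool.Properties
  using (∨-assoc; ∨-identityʳ; ∨-inverseʳ; ∧-identityʳ; ∧-distribˡ-∨; T-≡)
open import Data.Integer using (ℤ)
import Data.Integer.Properties as ℤP
open import Data.List using (_∷_; []; _++_)
open import Data.List.Membership.Propositional using (_∈_)
open import Data.List.Membership.DecPropositional ℤP._≟_ using (_∈?_)
open import Data.Product using (_,_)
open import Function.Bundles using (_⇔_; mk⇔; Equivalence)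
open import Relation.Nullary.Decidable using (Dec; yes; no; ⌊_⌋; toWitness; fromWitness)
open import Relation.Binary.PropositionalEquality using (_≡_; refl; sym; trans; cong; cong₂; subst; module ≡-Reasoning)
open ≡-Reasoning

T-⌊⌋⇔ : ∀ {p} {P : Set p} (P? : Dec P) → T ⌊ P? ⌋ ⇔ P
T-⌊⌋⇔ P? = mk⇔ toWitness fromWitness

-- ⌊_⌋ does not compute through the Dec.map′ inside any?, hence the case split.
∈?-∷ : ∀ x y ys → ⌊ x ∈? y ∷ ys ⌋ ≡ ⌊ x ℤP.≟ y ⌋ ∨ ⌊ x ∈? ys ⌋
∈?-∷ x y ys with x ℤP.≟ y | x ∈? ys
... | yes _ | _     = refl
... | no _  | yes _ = refl
... | no _  | no _  = refl

∈?-[-] : ∀ x y → ⌊ x ∈? y ∷ [] ⌋ ≡ ⌊ x ℤP.≟ y ⌋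
∈?-[-] x y = trans (∈?-∷ x y []) (∨-identityʳ _)

∈?-++ : ∀ x xs ys → ⌊ x ∈? xs ++ ys ⌋ ≡ ⌊ x ∈? xs ⌋ ∨ ⌊ x ∈? ys ⌋
∈?-++ x []       ys = refl
∈?-++ x (y ∷ xs) ys = begin
  ⌊ x ∈? y ∷ xs ++ ys ⌋                           ≡⟨ ∈?-∷ x y (xs ++ ys) ⟩
  ⌊ x ℤP.≟ y ⌋ ∨ ⌊ x ∈? xs ++ ys ⌋                ≡⟨ cong (⌊ x ℤP.≟ y ⌋ ∨_) (∈?-++ x xs ys) ⟩
  ⌊ x ℤP.≟ y ⌋ ∨ (⌊ x ∈? xs ⌋ ∨ ⌊ x ∈? ys ⌋)      ≡⟨ ∨-assoc ⌊ x ℤP.≟ y ⌋ _ _ ⟨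
  (⌊ x ℤP.≟ y ⌋ ∨ ⌊ x ∈? xs ⌋) ∨ ⌊ x ∈? ys ⌋      ≡⟨ cong (_∨ ⌊ x ∈? ys ⌋) (∈?-∷ x y xs) ⟨
  ⌊ x ∈? y ∷ xs ⌋ ∨ ⌊ x ∈? ys ⌋                   ∎

x∧y∨[x∧¬y∨z]≡x∨z : ∀ x y z → (x ∧ y) ∨ ((x ∧ not y) ∨ z) ≡ x ∨ z
x∧y∨[x∧¬y∨z]≡x∨z x y z = begin
  (x ∧ y) ∨ ((x ∧ not y) ∨ z)   ≡⟨ ∨-assoc (x ∧ y) _ z ⟨
  ((x ∧ y) ∨ (x ∧ not y)) ∨ z   ≡⟨ cong (_∨ z) (∧-distribˡ-∨ x y (not y)) ⟨
  (x ∧ (y ∨ not y)) ∨ z         ≡⟨ cong (λ b → (x ∧ b) ∨ z) (∨-inverseʳ y) ⟩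
  (x ∧ true) ∨ z                ≡⟨ cong (_∨ z) (∧-identityʳ x) ⟩
  x ∨ z                         ∎

enab-□ : ∀ g h σ → evalB (enab (g □ h)) σ ≡ evalB (enab g) σ ∨ evalB (enab h) σ
enab-□ [ e ⇒ c ]   h σ = refl
enab-□ (e ⇒ c □ g) h σ = begin
  evalB e σ ∨ evalB (enab (g □ h)) σ                      ≡⟨ cong (evalB e σ ∨_) (enab-□ g h σ) ⟩
  evalB e σ ∨ (evalB (enab g) σ ∨ evalB (enab h) σ)       ≡⟨ ∨-assoc (evalB e σ) _ _ ⟨
  (evalB e σ ∨ evalB (enab g) σ) ∨ evalB (enab h) σ       ∎

module _ (pc : Var) where
  open NormalForm pc

  enab-entry : ∀ n g σ → evalB (enab (entry n g)) σ ≡ ⌊ σ pc ℤP.≟ n ⌋ ∧ evalB (enab g) σ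
  enab-entry n [ e ⇒ d ]   σ = refl
  enab-entry n (e ⇒ d □ g) σ = begin
    (⌊ σ pc ℤP.≟ n ⌋ ∧ evalB e σ) ∨ evalB (enab (entry n g)) σ
      ≡⟨ cong ((⌊ σ pc ℤP.≟ n ⌋ ∧ evalB e σ) ∨_) (enab-entry n g σ) ⟩
    (⌊ σ pc ℤP.≟ n ⌋ ∧ evalB e σ) ∨ (⌊ σ pc ℤP.≟ n ⌋ ∧ evalB (enab g) σ)
      ≡⟨ ∧-distribˡ-∨ ⌊ σ pc ℤP.≟ n ⌋ _ _ ⟨
    ⌊ σ pc ℤP.≟ n ⌋ ∧ (evalB e σ ∨ evalB (enab g) σ)
      ∎

  mutual
    enab-▷ : ∀ {c f gcs} → WF c → c ▷[ f ] gcs →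
             ∀ σ → evalB (enab gcs) σ ≡ ⌊ σ pc ∈? labs c ⌋
    enab-▷ _ (nf-skip {n})   σ = sym (∈?-[-] (σ pc) n)
    enab-▷ _ (nf-assign {n}) σ = sym (∈?-[-] (σ pc) n)
    enab-▷ {c ⨾ d} (wc , wd) (nf-seq {g₀ = g₀} {g₁} c▷ d▷) σ = begin
      evalB (enab (g₀ □ g₁)) σ                   ≡⟨ enab-□ g₀ g₁ σ ⟩
      evalB (enab g₀) σ ∨ evalB (enab g₁) σ      ≡⟨ cong₂ _∨_ (enab-▷ wc c▷ σ) (enab-▷ wd d▷ σ) ⟩
      ⌊ σ pc ∈? labs c ⌋ ∨ ⌊ σ pc ∈? labs d ⌋    ≡⟨ ∈?-++ (σ pc) (labs c) (labs d) ⟨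
      ⌊ σ pc ∈? labs (c ⨾ d) ⌋                   ∎
    enab-▷ (valid , wg) (nf-if {n} {gcs} {G = G} gcs▷) σ = begin
      evalB (enab (entry n gcs □ G)) σ                              ≡⟨ enab-□ (entry n gcs) G σ ⟩
      evalB (enab (entry n gcs)) σ ∨ evalB (enab G) σ               ≡⟨ cong₂ _∨_ (enab-entry n gcs σ) (enab-▷G wg gcs▷ σ) ⟩
      (⌊ σ pc ℤP.≟ n ⌋ ∧ evalB (enab gcs) σ) ∨ ⌊ σ pc ∈? labsG gcs ⌋
        ≡⟨ cong (λ b → (⌊ σ pc ℤP.≟ n ⌋ ∧ b) ∨ ⌊ σ pc ∈? labsG gcs ⌋) (Equivalence.to T-≡ (valid σ)) ⟩
      (⌊ σ pc ℤP.≟ n ⌋ ∧ true) ∨ ⌊ σ pc ∈? labsG gcs ⌋              ≡⟨ cong (_∨ ⌊ σ pc ∈? labsG gcs ⌋) (∧-identityʳ _) ⟩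
      ⌊ σ pc ℤP.≟ n ⌋ ∨ ⌊ σ pc ∈? labsG gcs ⌋                       ≡⟨ ∈?-∷ (σ pc) n (labsG gcs) ⟨
      ⌊ σ pc ∈? labs (ifc n gcs) ⌋                                  ∎
    enab-▷ wg (nf-do {n} {gcs} {f} {G} gcs▷) σ = begin
      evalB (enab (entry n gcs □ exit □ G)) σ
        ≡⟨ enab-□ (entry n gcs) (exit □ G) σ ⟩
      evalB (enab (entry n gcs)) σ ∨ evalB (enab (exit □ G)) σ
        ≡⟨ cong₂ _∨_ (enab-entry n gcs σ) (enab-□ exit G σ) ⟩
      (atn ∧ evalB (enab gcs) σ) ∨ ((atn ∧ not (evalB (enab gcs) σ)) ∨ evalB (enab G) σ)
        ≡⟨ x∧y∨[x∧¬y∨z]≡x∨z atn _ _ ⟩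
      atn ∨ evalB (enab G) σ
        ≡⟨ cong (atn ∨_) (enab-▷G wg gcs▷ σ) ⟩
      atn ∨ ⌊ σ pc ∈? labsG gcs ⌋
        ≡⟨ ∈?-∷ (σ pc) n (labsG gcs) ⟨
      ⌊ σ pc ∈? labs (doc n gcs) ⌋
        ∎
      where
      exit : GCS
      exit = [ ((¿ n) ∧ᵇ bnot (enab gcs)) ⇒ (! f) ]
      atn : Bool
      atn = ⌊ σ pc ℤP.≟ n ⌋

    enab-▷G : ∀ {gs f G} → WFG gs → gs ▷G[ f ] G →
              ∀ σ → evalB (enab G) σ ≡ ⌊ σ pc ∈? labsG gs ⌋
    enab-▷G wd (nfg-one d▷) σ = enab-▷ wd d▷ σ
    enab-▷G {e ⇒ d □ gs} (wd , wgs) (nfg-cons {g = g} {G = G} d▷ gs▷) σ = begin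
      evalB (enab (g □ G)) σ                       ≡⟨ enab-□ g G σ ⟩
      evalB (enab g) σ ∨ evalB (enab G) σ          ≡⟨ cong₂ _∨_ (enab-▷ wd d▷ σ) (enab-▷G wgs gs▷ σ) ⟩
      ⌊ σ pc ∈? labs d ⌋ ∨ ⌊ σ pc ∈? labsG gs ⌋    ≡⟨ ∈?-++ (σ pc) (labs d) (labsG gs) ⟨
      ⌊ σ pc ∈? labsG (e ⇒ d □ gs) ⌋               ∎

lemma5p20 : (pc : Var) (c : Cmd) (f : ℤ) (gcs : GCS) →
            WF c → okf c f → NormalForm._▷[_]_ pc c f gcs →
            ∀ (σ : Store) → ⟦ enab gcs ⟧ σ ⇔ (σ pc ∈ labs c)
lemma5p20 pc c f gcs wf _ c▷ σ =
  subst (λ b → T b ⇔ (σ pc ∈ labs c)) (sym (enab-▷ pc wf c▷ σ)) (T-⌊⌋⇔ (σ pc ∈? labs c))
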